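{- Let $a<b$ be coprime positive integers and let $c\in\mathbb{Z}$ with $k=\lfloor c/(ab)\rfloor>0$. Let $$B_0=\{(x,y)\in\mathbb{Z}_{\geq 0}^2 \;|\; ax+by\leq c,\ 0\leq x<b\},$$ and let $f(S)=ab-a-b$ be the Frobenius number of the numerical semigroup $S=\langle a,b\rangle$. Then $$\# B_0=\frac{a+b-ab+1}{2}+c=\frac{1-f(S)}{2}+c.$$
   Context: For coprime positive integers $a,b$, $S=\langle a,b\rangle=\{\lambda_1 a+\lambda_2 b : \lambda_1,\lambda_2\in\mathbb{Z}_{\ge 0}\}$ is the numerical semigroup generated by $a,b$; its Frobenius number $f(S)$ is the largest nonnegative integer not in $S$, which equals $ab-a-b$. -}

module Defs where

open import Data.Nat using (ℕ; _<_)
open import Data.Integer using (ℤ; +_; _+_; _*_; _≤_)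
open import Data.Product using (Σ; _×_)

B₀ : ℕ → ℕ → ℤ → Set
B₀ a b c = Σ (ℕ × ℕ) λ p →
  let x = Data.Product.proj₁ p ; y = Data.Product.proj₂ p in
  ((+ a) * (+ x) + (+ b) * (+ y) ≤ c) × (x < b)

frob : ℕ → ℕ → ℤ
frob a b = Data.Integer._-_ (Data.Integer._-_ (+ (a Data.Nat.* b)) (+ a)) (+ b)

-- Column by column, B₀ has ⌊(c − a x)/b⌋ + 1 points over each x < b. Write
-- c − a x = q_x b + r_x. Since gcd(a, b) = 1, the remainders r_x (x < b) are
-- the residues 0, …, b − 1 in some order, so Σ r_x = b(b − 1)/2, and summing
-- c − a x = q_x b + r_x over x < b then pins down Σ q_x, hence #B₀ = b + Σ q_x.
module Submission where

open import Data.Nat using (ℕ; NonZero)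
import Data.Nat as ℕ
open import Data.Nat.Coprimality using (Coprime)

module Counting where
  open import Data.Nat
  open import Data.Nat.Properties
  open import Data.Nat.Tactic.RingSolver using (solve-∀)
  open import Algebra.Properties.Semiring.Sum +-*-semiring
    using (sum-syntax; ∑-distrib-+; sum-permute)
  open import Data.Fin using (Fin; zero; suc; toℕ; fromℕ<; punchOut)
  import Data.Fin.Properties as Finₚ
  open Finₚ using (+↔⊎; toℕ<n; toℕ-fromℕ<; fromℕ<-toℕ; any?; injective⇒≤; punchOut-injective)
  open import Data.Product using (Σ; ∃; _×_; _,_; proj₁; proj₂)
  open import Data.Product.Function.Dependent.Propositional using (Σ-↔)
  open import Data.Sum using (_⊎_; inj₁; inj₂)
  open import Data.Sum.Function.Propositional using (_⊎-↔_)
  open import Function using (_∘_)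
  open import Function.Bundles using (_↔_; _⇔_; mk↔ₛ′; Equivalence)
  open import Function.Definitions using (Injective)
  open import Function.Properties.Inverse using (↔-refl; ↔-sym; ↔-trans)
  open import Relation.Binary.PropositionalEquality
  open import Relation.Nullary using (Irrelevant; yes; no; contradiction)

  ∑-const : ∀ n c → ∑[ i < n ] c ≡ n * c
  ∑-const zero    c = refl
  ∑-const (suc n) c = cong (c +_) (∑-const n c)

  2*∑i+n≡n*n : ∀ n → 2 * ∑[ i < n ] toℕ i + n ≡ n * n
  2*∑i+n≡n*n zero    = refl
  2*∑i+n≡n*n (suc n) = begin
    2 * ∑[ i < n ] (1 + toℕ i) + suc n            ≡⟨ cong (λ s → 2 * s + suc n) (∑-distrib-+ {n} (λ _ → 1) toℕ) ⟩
    2 * (∑[ i < n ] 1 + ∑[ i < n ] toℕ i) + suc n ≡⟨ cong (λ s → 2 * (s + ∑[ i < n ] toℕ i) + suc n) (∑-const n 1) ⟩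
    2 * (n * 1 + ∑[ i < n ] toℕ i) + suc n        ≡⟨ regroup n (∑[ i < n ] toℕ i) ⟩
    (2 * ∑[ i < n ] toℕ i + n) + 2 * n + 1        ≡⟨ cong (λ s → s + 2 * n + 1) (2*∑i+n≡n*n n) ⟩
    n * n + 2 * n + 1                             ≡⟨ square-suc n ⟩
    suc n * suc n                                 ∎
    where
    open ≡-Reasoning
    regroup : ∀ n s → 2 * (n * 1 + s) + suc n ≡ (2 * s + n) + 2 * n + 1
    regroup = solve-∀
    square-suc : ∀ n → n * n + 2 * n + 1 ≡ suc n * suc n
    square-suc = solve-∀

  Σ-Fin-suc↔⊎ : ∀ {n} {P : Fin (suc n) → Set} → Σ (Fin (suc n)) P ↔ (P zero ⊎ Σ (Fin n) (P ∘ suc))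
  Σ-Fin-suc↔⊎ {n} {P} = mk↔ₛ′ to from to∘from from∘to
    where
    to : Σ (Fin (suc n)) P → P zero ⊎ Σ (Fin n) (P ∘ suc)
    to (zero  , p) = inj₁ p
    to (suc i , p) = inj₂ (i , p)
    from : P zero ⊎ Σ (Fin n) (P ∘ suc) → Σ (Fin (suc n)) P
    from (inj₁ p)       = zero , p
    from (inj₂ (i , p)) = suc i , p
    to∘from : ∀ s → to (from s) ≡ s
    to∘from (inj₁ p)       = refl
    to∘from (inj₂ (i , p)) = refl
    from∘to : ∀ s → from (to s) ≡ s
    from∘to (zero  , p) = refl
    from∘to (suc i , p) = refl

  Fin-∑↔Σ : ∀ n (h : Fin n → ℕ) → Fin (∑[ i < n ] h i) ↔ Σ (Fin n) (Fin ∘ h)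
  Fin-∑↔Σ zero    h = mk↔ₛ′ (λ ()) (λ { (() , _) }) (λ { (() , _) }) (λ ())
  Fin-∑↔Σ (suc n) h =
    ↔-trans +↔⊎ (↔-trans (↔-refl ⊎-↔ Fin-∑↔Σ n (h ∘ suc)) (↔-sym Σ-Fin-suc↔⊎))

  Fin↔< : ∀ {n} → Fin n ↔ Σ ℕ (_< n)
  Fin↔< = mk↔ₛ′ (λ i → toℕ i , toℕ<n i) (λ (m , m<n) → fromℕ< m<n) to∘from (λ i → fromℕ<-toℕ i (toℕ<n i))
    where
    to∘from : ∀ {n} (p : Σ ℕ (_< n)) → (toℕ (fromℕ< (proj₂ p)) , toℕ<n _) ≡ p
    to∘from (m , m<n) with toℕ (fromℕ< m<n) | toℕ-fromℕ< m<n | toℕ<n (fromℕ< m<n)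
    ... | .m | refl | lt = cong (m ,_) (<-irrelevant lt m<n)

  Hypograph : ℕ → (ℕ → ℕ) → Set
  Hypograph n h = Σ (ℕ × ℕ) λ (x , y) → y < h x × x < n

  Fin-∑↔Hypograph : ∀ n (h : ℕ → ℕ) → Fin (∑[ i < n ] h (toℕ i)) ↔ Hypograph n h
  Fin-∑↔Hypograph n h = ↔-trans (Fin-∑↔Σ n (h ∘ toℕ)) (↔-trans (Σ-↔ Fin↔< Fin↔<) reassoc)
    where
    reassoc : Σ (Σ ℕ (_< n)) (λ (x , _) → Σ ℕ (_< h x)) ↔ Hypograph n h
    reassoc = mk↔ₛ′ (λ ((x , x<n) , (y , y<h)) → (x , y) , y<h , x<n)
                    (λ ((x , y) , y<h , x<n) → (x , x<n) , (y , y<h))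
                    (λ _ → refl) (λ _ → refl)

  ×-irrelevant : ∀ {A B : Set} → Irrelevant A → Irrelevant B → Irrelevant (A × B)
  ×-irrelevant irrA irrB (a , b) (a′ , b′) = cong₂ _,_ (irrA a a′) (irrB b b′)

  irrelevant-⇔⇒↔ : ∀ {A B : Set} → Irrelevant A → Irrelevant B → A ⇔ B → A ↔ B
  irrelevant-⇔⇒↔ irrA irrB A⇔B =
    mk↔ₛ′ (Equivalence.to A⇔B) (Equivalence.from A⇔B) (λ _ → irrB _ _) (λ _ → irrA _ _)

  Fin-injective⇒surjective : ∀ {n} (f : Fin n → Fin n) → Injective _≡_ _≡_ f → ∀ j → ∃ λ i → f i ≡ j
  Fin-injective⇒surjective {suc n} f f-inj j with any? (λ i → f i Finₚ.≟ j)
  ... | yes hit = hit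
  ... | no miss = contradiction (injective⇒≤ avoid-j-injective) (1+n≰n {n})
    where
    avoid-j : Fin (suc n) → Fin n
    avoid-j i = punchOut {i = j} (λ j≡fi → miss (i , sym j≡fi))
    avoid-j-injective : Injective _≡_ _≡_ avoid-j
    avoid-j-injective eq = f-inj (punchOut-injective {i = j} _ _ eq)

  ∑-reindex-injective : ∀ {n} (g : Fin n → ℕ) (f : Fin n → Fin n) → Injective _≡_ _≡_ f →
                        ∑[ i < n ] g (f i) ≡ ∑[ i < n ] g i
  ∑-reindex-injective g f f-inj = sym (sum-permute g π)
    where
    surj : ∀ j → ∃ λ i → f i ≡ j
    surj = Fin-injective⇒surjective f f-inj
    π : Fin _ ↔ Fin _
    π = mk↔ₛ′ f (proj₁ ∘ surj) (proj₂ ∘ surj) (λ i → f-inj (proj₂ (surj (f i))))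

module Division where
  open import Data.Nat
  open import Data.Nat.Properties
  open import Data.Nat.DivMod
  open import Data.Nat.Divisibility using (_∣_; divides; ∣m+n∣m⇒∣n; n∣m*n)
  open import Function.Bundles using (_⇔_; mk⇔)
  open import Relation.Binary.PropositionalEquality

  m%n≡[m+d]%n⇒n∣d : ∀ m d n .{{_ : NonZero n}} → m % n ≡ (m + d) % n → n ∣ d
  m%n≡[m+d]%n⇒n∣d m d n eq = ∣m+n∣m⇒∣n (divides ((m + d) / n) quotients) (n∣m*n (m / n))
    where
    open ≡-Reasoning
    quotients : m / n * n + d ≡ (m + d) / n * n
    quotients = +-cancelˡ-≡ (m % n) _ _ (begin
      m % n + (m / n * n + d)        ≡⟨ sym (+-assoc (m % n) _ d) ⟩
      m % n + m / n * n + d          ≡⟨ cong (_+ d) (sym (m≡m%n+[m/n]*n m n)) ⟩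
      m + d                          ≡⟨ m≡m%n+[m/n]*n (m + d) n ⟩
      (m + d) % n + (m + d) / n * n  ≡⟨ cong (_+ (m + d) / n * n) (sym eq) ⟩
      m % n + (m + d) / n * n        ∎)

  y<1+m/n⇔n*y≤m : ∀ m n y .{{_ : NonZero n}} → (y < suc (m / n)) ⇔ (n * y ≤ m)
  y<1+m/n⇔n*y≤m m n y = mk⇔
    (λ { (s≤s y≤m/n) → ≤-trans (≤-reflexive (*-comm n y)) (≤-trans (*-monoˡ-≤ n y≤m/n) (m/n*n≤m m n)) })
    (λ ny≤m → s≤s (≤-trans (≤-reflexive (sym (m*n/n≡m y n))) (/-monoˡ-≤ n (≤-trans (≤-reflexive (*-comm y n)) ny≤m))))

module Strip {a b C : ℕ} .{{_ : NonZero b}} (coprime : Coprime a b) (ab≤C : a ℕ.* b ℕ.≤ C) where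
  open import Data.Nat
  open import Data.Nat.Properties
  open import Data.Nat.DivMod
  open import Data.Nat.Divisibility using (_∣_; n∣m⇒m%n≡0)
  import Data.Nat.Coprimality as Coprimality
  open import Data.Nat.Tactic.RingSolver using (solve-∀)
  open import Algebra.Properties.Semiring.Sum +-*-semiring
    using (sum-syntax; ∑-distrib-+; sum-cong-≗; *-distribˡ-sum; *-distribʳ-sum)
  open import Data.Fin using (Fin; toℕ)
  open import Data.Fin.Properties using (toℕ<n; toℕ-fromℕ<; toℕ-injective)
  import Data.Integer as ℤ
  import Data.Integer.Properties as ℤ
  open import Data.Product using (_,_)
  open import Data.Product.Function.Dependent.Propositional using (Σ-↔)
  open import Data.Sum using (inj₁; inj₂)
  open import Function using (_∘_)
  open import Function.Bundles using (_↔_; _⇔_; mk⇔; Equivalence)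
  open import Function.Definitions using (Injective)
  import Function.Properties.Equivalence as ⇔
  open import Function.Properties.Inverse using (↔-refl; ↔-sym; ↔-trans)
  open import Relation.Binary.PropositionalEquality
  open import Defs using (B₀)
  open Counting
  open Division

  ax≤C : ∀ {x} → x < b → a * x ≤ C
  ax≤C x<b = ≤-trans (*-monoʳ-≤ a (<⇒≤ x<b)) ab≤C

  -- C ∸ a * x is the true difference only for x < b (ax≤C), the only range used.
  quotient remainder : ℕ → ℕ
  quotient  x = (C ∸ a * x) / b
  remainder x = (C ∸ a * x) % b

  division-identity : ∀ {x} → x < b → remainder x + quotient x * b + a * x ≡ C
  division-identity {x} x<b =
    trans (cong (_+ a * x) (sym (m≡m%n+[m/n]*n (C ∸ a * x) b))) (m∸n+n≡m (ax≤C x<b))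

  remainders-distinct : ∀ {x x′} → x ≤ x′ → x′ < b → remainder x ≡ remainder x′ → x ≡ x′
  remainders-distinct {x} {x′} x≤x′ x′<b same = ≤-antisym x≤x′ (m∸n≡0⇒m≤n gap≡0)
    where
    open ≡-Reasoning
    split : C ∸ a * x ≡ (C ∸ a * x′) + a * (x′ ∸ x)
    split = begin
      C ∸ a * x                         ≡⟨ cong (_∸ a * x) (sym (m∸n+n≡m (ax≤C x′<b))) ⟩
      (C ∸ a * x′) + a * x′ ∸ a * x     ≡⟨ +-∸-assoc (C ∸ a * x′) (*-monoʳ-≤ a x≤x′) ⟩
      (C ∸ a * x′) + (a * x′ ∸ a * x)   ≡⟨ cong ((C ∸ a * x′) +_) (sym (*-distribˡ-∸ a x′ x)) ⟩
      (C ∸ a * x′) + a * (x′ ∸ x)       ∎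
    b∣gap : b ∣ x′ ∸ x
    b∣gap = Coprimality.coprime-divisor (Coprimality.sym coprime)
      (m%n≡[m+d]%n⇒n∣d (C ∸ a * x′) (a * (x′ ∸ x)) b (trans (sym same) (cong (_% b) split)))
    gap≡0 : x′ ∸ x ≡ 0
    gap≡0 = trans (sym (m<n⇒m%n≡m (≤-<-trans (m∸n≤m x′ x) x′<b))) (n∣m⇒m%n≡0 _ b b∣gap)

  residue : Fin b → Fin b
  residue i = (C ∸ a * toℕ i) mod b

  toℕ-residue : ∀ i → toℕ (residue i) ≡ remainder (toℕ i)
  toℕ-residue i = toℕ-fromℕ< (m%n<n (C ∸ a * toℕ i) b)

  same-remainder : ∀ {i j} → residue i ≡ residue j → remainder (toℕ i) ≡ remainder (toℕ j)
  same-remainder {i} {j} eq = trans (sym (toℕ-residue i)) (trans (cong toℕ eq) (toℕ-residue j))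

  residue-injective : Injective _≡_ _≡_ residue
  residue-injective {i} {j} eq with ≤-total (toℕ i) (toℕ j)
  ... | inj₁ i≤j = toℕ-injective (remainders-distinct i≤j (toℕ<n j) (same-remainder eq))
  ... | inj₂ j≤i = sym (toℕ-injective (remainders-distinct j≤i (toℕ<n i) (same-remainder (sym eq))))

  ∑-residues : ∑[ i < b ] remainder (toℕ i) ≡ ∑[ i < b ] toℕ i
  ∑-residues = trans (sum-cong-≗ {b} (sym ∘ toℕ-residue)) (∑-reindex-injective toℕ residue residue-injective)

  ∑-division-identity :
    ∑[ i < b ] toℕ i + (∑[ i < b ] quotient (toℕ i)) * b + a * ∑[ i < b ] toℕ i ≡ b * C
  ∑-division-identity = begin
    S + Q * b + a * S
      ≡⟨ cong₂ (λ s t → s + Q * b + t) (sym ∑-residues) (*-distribˡ-sum {b} a toℕ) ⟩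
    ∑[ i < b ] remainder (toℕ i) + Q * b + ∑[ i < b ] (a * toℕ i)
      ≡⟨ cong (λ t → ∑[ i < b ] remainder (toℕ i) + t + ∑[ i < b ] (a * toℕ i))
              (*-distribʳ-sum {b} b (quotient ∘ toℕ)) ⟩
    ∑[ i < b ] remainder (toℕ i) + ∑[ i < b ] (quotient (toℕ i) * b) + ∑[ i < b ] (a * toℕ i)
      ≡⟨ cong (_+ ∑[ i < b ] (a * toℕ i)) (∑-distrib-+ {b} (remainder ∘ toℕ) (λ i → quotient (toℕ i) * b)) ⟨
    ∑[ i < b ] (remainder (toℕ i) + quotient (toℕ i) * b) + ∑[ i < b ] (a * toℕ i)
      ≡⟨ ∑-distrib-+ {b} (λ i → remainder (toℕ i) + quotient (toℕ i) * b) (λ i → a * toℕ i) ⟨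
    ∑[ i < b ] (remainder (toℕ i) + quotient (toℕ i) * b + a * toℕ i)
      ≡⟨ sum-cong-≗ {b} (λ i → division-identity (toℕ<n i)) ⟩
    ∑[ i < b ] C
      ≡⟨ ∑-const b C ⟩
    b * C ∎
    where
    open ≡-Reasoning
    S Q : ℕ
    S = ∑[ i < b ] toℕ i
    Q = ∑[ i < b ] quotient (toℕ i)

  #points : ℕ
  #points = ∑[ i < b ] suc (quotient (toℕ i))

  count : 2 * #points + a * b ≡ 2 * C + a + b + 1
  count = *-cancelˡ-≡ _ _ b (begin
    b * (2 * ∑[ i < b ] (1 + quotient (toℕ i)) + a * b)
      ≡⟨ cong (λ n → b * (2 * n + a * b)) (trans (∑-distrib-+ {b} (λ _ → 1) (quotient ∘ toℕ)) (cong (_+ Q) (∑-const b 1))) ⟩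
    b * (2 * (b * 1 + Q) + a * b)                    ≡⟨ expand-left b Q a ⟩
    (a + 2) * (b * b) + 2 * Q * b                     ≡⟨ cong (λ t → (a + 2) * t + 2 * Q * b) (sym (2*∑i+n≡n*n b)) ⟩
    (a + 2) * (2 * S + b) + 2 * Q * b                 ≡⟨ regroup S Q a b ⟩
    2 * (S + Q * b + a * S) + a * b + (2 * S + b) + b ≡⟨ cong₂ (λ s t → 2 * s + a * b + t + b) ∑-division-identity (2*∑i+n≡n*n b) ⟩
    2 * (b * C) + a * b + b * b + b                   ≡⟨ expand-right C a b ⟩
    b * (2 * C + a + b + 1)                           ∎)
    where
    open ≡-Reasoning
    S Q : ℕ
    S = ∑[ i < b ] toℕ i
    Q = ∑[ i < b ] quotient (toℕ i)
    expand-left : ∀ b Q a → b * (2 * (b * 1 + Q) + a * b) ≡ (a + 2) * (b * b) + 2 * Q * b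
    expand-left = solve-∀
    regroup : ∀ S Q a b → (a + 2) * (2 * S + b) + 2 * Q * b ≡ 2 * (S + Q * b + a * S) + a * b + (2 * S + b) + b
    regroup = solve-∀
    expand-right : ∀ C a b → 2 * (b * C) + a * b + b * b + b ≡ b * (2 * C + a + b + 1)
    expand-right = solve-∀

  B₀↔Hypograph : B₀ a b (ℤ.+ C) ↔ Hypograph b (suc ∘ quotient)
  B₀↔Hypograph = Σ-↔ ↔-refl (irrelevant-⇔⇒↔
    (×-irrelevant ℤ.≤-irrelevant <-irrelevant)
    (×-irrelevant <-irrelevant <-irrelevant)
    (mk⇔ (λ (le , x<b) → Equivalence.to (below⇔ x<b) le , x<b)
         (λ (lt , x<b) → Equivalence.from (below⇔ x<b) lt , x<b)))
    where
    below⇔ : ∀ {x y} → x < b → (ℤ.+ a ℤ.* ℤ.+ x ℤ.+ ℤ.+ b ℤ.* ℤ.+ y ℤ.≤ ℤ.+ C) ⇔ (y < suc (quotient x))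
    below⇔ {x} {y} x<b = ⇔.trans cast (⇔.trans (mk⇔ shift unshift) (⇔.sym (y<1+m/n⇔n*y≤m (C ∸ a * x) b y)))
      where
      pos-linear : ℤ.+ a ℤ.* ℤ.+ x ℤ.+ ℤ.+ b ℤ.* ℤ.+ y ≡ ℤ.+ (a * x + b * y)
      pos-linear = sym (trans (ℤ.pos-+ (a * x) (b * y)) (cong₂ ℤ._+_ (ℤ.pos-* a x) (ℤ.pos-* b y)))
      cast : (ℤ.+ a ℤ.* ℤ.+ x ℤ.+ ℤ.+ b ℤ.* ℤ.+ y ℤ.≤ ℤ.+ C) ⇔ (a * x + b * y ≤ C)
      cast = mk⇔ (ℤ.drop‿+≤+ ∘ subst (ℤ._≤ ℤ.+ C) pos-linear) (subst (ℤ._≤ ℤ.+ C) (sym pos-linear) ∘ ℤ.+≤+)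
      shift : a * x + b * y ≤ C → b * y ≤ C ∸ a * x
      shift le = m+n≤o⇒m≤o∸n (b * y) (≤-trans (≤-reflexive (+-comm (b * y) (a * x))) le)
      unshift : b * y ≤ C ∸ a * x → a * x + b * y ≤ C
      unshift le = ≤-trans (≤-reflexive (+-comm (a * x) (b * y))) (m≤o∸n⇒m+n≤o (b * y) (ax≤C x<b) le)

  Fin↔B₀ : Fin #points ↔ B₀ a b (ℤ.+ C)
  Fin↔B₀ = ↔-trans (Fin-∑↔Hypograph b (suc ∘ quotient)) (↔-sym B₀↔Hypograph)

open import Defs
open import Data.Nat using (ℕ; _<_; NonZero)
open import Data.Nat.Coprimality using (Coprime)
open import Data.Integer using (ℤ; +_; _+_; _-_; _*_; _/ℕ_)
open import Data.Fin using (Fin)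
open import Data.Product using (Σ; _×_)
open import Function.Bundles using (_↔_)
open import Relation.Binary.PropositionalEquality using (_≡_)

open import Data.Integer using (_≤_; +≤+)
open import Data.Integer.DivMod using ([n/ℕd]*d≤n)
open import Data.Integer.Properties using (i<j⇒suc[i]≤j; *-identityˡ; *-monoʳ-≤-nonNeg; pos-+; pos-*; module ≤-Reasoning)
open import Data.Integer.Tactic.RingSolver using (solve-∀)
open import Data.Product using (_,_)
open import Relation.Binary.PropositionalEquality using (sym; trans; cong; cong₂; module ≡-Reasoning)

0<c/ℕd⇒d≤c : ∀ c d .{{_ : NonZero d}} → + 0 Data.Integer.< c /ℕ d → + d ≤ c
0<c/ℕd⇒d≤c c d 0<c/d = begin
  + d          ≡⟨ sym (*-identityˡ (+ d)) ⟩
  + 1 * + d    ≤⟨ *-monoʳ-≤-nonNeg (+ d) (i<j⇒suc[i]≤j 0<c/d) ⟩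
  c /ℕ d * + d ≤⟨ [n/ℕd]*d≤n c d ⟩
  c            ∎
  where open ≤-Reasoning

2n+ab≡2C+a+b+1⇒2n≡a+b-ab+1+2C : ∀ n a b C →
  2 ℕ.* n ℕ.+ a ℕ.* b ≡ 2 ℕ.* C ℕ.+ a ℕ.+ b ℕ.+ 1 →
  + 2 * + n ≡ + a + + b - + a * + b + + 1 + + 2 * + C
2n+ab≡2C+a+b+1⇒2n≡a+b-ab+1+2C n a b C eq = begin
  + 2 * + n                                 ≡⟨ isolate (+ n) (+ a * + b) ⟩
  + 2 * + n + + a * + b - + a * + b         ≡⟨ cong (_- + a * + b) lifted ⟩
  + 2 * + C + + a + + b + + 1 - + a * + b   ≡⟨ rearrange (+ a) (+ b) (+ C) ⟩
  + a + + b - + a * + b + + 1 + + 2 * + C   ∎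
  where
  open ≡-Reasoning
  isolate : ∀ n p → + 2 * n ≡ + 2 * n + p - p
  isolate = solve-∀
  rearrange : ∀ a b C → + 2 * C + a + b + + 1 - a * b ≡ a + b - a * b + + 1 + + 2 * C
  rearrange = solve-∀
  lifted : + 2 * + n + + a * + b ≡ + 2 * + C + + a + + b + + 1
  lifted = begin
    + 2 * + n + + a * + b               ≡⟨ cong₂ _+_ (pos-* 2 n) (pos-* a b) ⟨
    + (2 ℕ.* n) + + (a ℕ.* b)           ≡⟨ pos-+ (2 ℕ.* n) (a ℕ.* b) ⟨
    + (2 ℕ.* n ℕ.+ a ℕ.* b)             ≡⟨ cong +_ eq ⟩
    + (2 ℕ.* C ℕ.+ a ℕ.+ b ℕ.+ 1)       ≡⟨ pos-+ (2 ℕ.* C ℕ.+ a ℕ.+ b) 1 ⟩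
    + (2 ℕ.* C ℕ.+ a ℕ.+ b) + + 1       ≡⟨ cong (_+ + 1) (pos-+ (2 ℕ.* C ℕ.+ a) b) ⟩
    + (2 ℕ.* C ℕ.+ a) + + b + + 1       ≡⟨ cong (λ t → t + + b + + 1) (pos-+ (2 ℕ.* C) a) ⟩
    + (2 ℕ.* C) + + a + + b + + 1       ≡⟨ cong (λ t → t + + a + + b + + 1) (pos-* 2 C) ⟩
    + 2 * + C + + a + + b + + 1         ∎

a+b-ab+1≡1-frob : ∀ a b → + a + + b - + a * + b + + 1 ≡ + 1 - frob a b
a+b-ab+1≡1-frob a b = trans (regroup (+ a) (+ b) (+ a * + b)) (cong (λ ab → + 1 - (ab - + a - + b)) (sym (pos-* a b)))
  where
  regroup : ∀ a b ab → a + b - ab + + 1 ≡ + 1 - (ab - a - b)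
  regroup = solve-∀

lemma3p1 : (a b : ℕ) → 0 < a → 0 < b → Coprime a b → a < b →
    (c : ℤ) → .{{_ : NonZero (a Data.Nat.* b)}} →
    Data.Integer._<_ (+ 0) (c /ℕ (a Data.Nat.* b)) →
    Σ ℕ λ n → (Fin n ↔ B₀ a b c) ×
    ((+ 2) * (+ n) ≡ (+ a) + (+ b) - (+ a) * (+ b) + (+ 1) + (+ 2) * c) ×
    ((+ 2) * (+ n) ≡ (+ 1) - frob a b + (+ 2) * c)
lemma3p1 a b _ 0<b coprime _ c k>0 with 0<c/ℕd⇒d≤c c (a ℕ.* b) k>0
... | +≤+ {n = C} ab≤C = #points , Fin↔B₀ , closed-form , trans closed-form with-frob
  where
  instance
    b≢0 : NonZero b
    b≢0 = ℕ.>-nonZero 0<b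
  open Strip coprime ab≤C
  closed-form : + 2 * + #points ≡ + a + + b - + a * + b + + 1 + + 2 * + C
  closed-form = 2n+ab≡2C+a+b+1⇒2n≡a+b-ab+1+2C #points a b C count
  with-frob : + a + + b - + a * + b + + 1 + + 2 * + C ≡ + 1 - frob a b + + 2 * + C
  with-frob = cong (_+ + 2 * + C) (a+b-ab+1≡1-frob a b)
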